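{- Let $m,n \geq 4$ be even integers and let $1 \leq d \leq n/2-1$. Then the Cayley graph $\mathrm{Cay}(\mathbb{Z}_m \times \mathbb{Z}_n, \{\pm 1\}\times\{\pm d\})$ admits a $C_m$-factorization consisting of two $C_m$-factors.
   Context: For a finite additive group $\Gamma$ and a subset $S\subseteq \Gamma\setminus\{0\}$ with $S=-S$, the Cayley graph $\mathrm{Cay}(\Gamma,S)$ has vertex set $\Gamma$ and edge set $\{\{a,b\}: a,b\in\Gamma,\ a-b\in S\}$. Here $\{\pm 1\}\times\{\pm d\}=\{(\epsilon,\delta d): \epsilon,\delta\in\{1,-1\}\}\subseteq \mathbb{Z}_m\times\mathbb{Z}_n$. A $C_k$-factor of a graph is a spanning subgraph each of whose components is a cycle of length $k$; a $C_k$-factorization is a partition of the edge set into $C_k$-factors. -}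

module Defs where

open import Data.Nat using (ℕ; zero; suc; _+_; _∸_; _≤_)
open import Data.Nat.DivMod using (_%_; m%n<n)
open import Data.Fin using (Fin; toℕ; fromℕ<)
open import Data.Product using (_×_; _,_; ∃; ∃-syntax)
open import Data.Sum using (_⊎_)
open import Data.Empty using (⊥)
open import Relation.Binary.PropositionalEquality using (_≡_)
open import Function.Definitions using (Bijective)

Graph : Set → Set₁
Graph V = V → V → Set

-- (a - b) mod m, as a natural number in [0, m), for a b ∈ ℤ_m ≅ Fin m.
diffMod : (m : ℕ) → Fin m → Fin m → ℕ
diffMod (suc k) a b = (toℕ a + (suc k ∸ toℕ b)) % suc k

CayPM : (m n d : ℕ) → Graph (Fin m × Fin n)
CayPM m n d (a₁ , a₂) (b₁ , b₂) =
  (diffMod m a₁ b₁ ≡ 1 ⊎ diffMod m a₁ b₁ ≡ m ∸ 1)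
  × (diffMod n a₂ b₂ ≡ d ⊎ diffMod n a₂ b₂ ≡ n ∸ d)

next : ∀ {k} → Fin k → Fin k
next {suc k} i = fromℕ< (m%n<n (suc (toℕ i)) (suc k))

-- A C_k-factor of G: a spanning subgraph whose components are k-cycles,
-- given as t vertex-disjoint k-cycles (cycle j visits vertex j i, then
-- vertex j (i+1 mod k), ...) covering every vertex exactly once; every
-- cycle edge is an edge of G.
record CFactor {V : Set} (G : Graph V) (k : ℕ) : Set where
  field
    t      : ℕ
    vertex : Fin t × Fin k → V
    bij    : Bijective _≡_ _≡_ vertex
    inG    : ∀ j i → G (vertex (j , i)) (vertex (j , next i))

FactorEdge : {V : Set} {G : Graph V} {k : ℕ} → CFactor G k → V → V → Set
FactorEdge F u v =
  ∃[ j ] ∃[ i ] ((u ≡ vertex (j , i) × v ≡ vertex (j , next i))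
              ⊎ (v ≡ vertex (j , i) × u ≡ vertex (j , next i)))
  where open CFactor F

record TwoCFactorization {V : Set} (G : Graph V) (k : ℕ) : Set where
  field
    k≥3      : 3 ≤ k
    F₁       : CFactor G k
    F₂       : CFactor G k
    cover    : ∀ u v → G u v → FactorEdge F₁ u v ⊎ FactorEdge F₂ u v
    disjoint : ∀ u v → FactorEdge F₁ u v → FactorEdge F₂ u v → ⊥

-- Index the two factors by a sign σ and put s₊ = d, s₋ = −d (mod n). In factor σ, cycle j
-- (j ∈ ℤ_n) runs through the columns 0, 1, …, m − 1 of ℤ_m × ℤ_n, lying in row j at even
-- columns and in row j + s_σ at odd ones; since m is even this closes up into an m-cycle, and
-- the n cycles partition the vertices. Between columns i and i + 1 factor σ thus moves by the
-- row step s_σ for even i and by −s_σ for odd i, so the two row steps ±d are taken by different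
-- factors at every column: every edge lies in exactly one factor, as d ≢ −d (mod n) and, for
-- m ≥ 3, no edge is traversed from column i to i + 1 in one factor and backwards in the other.
module Submission where

open import Defs
open import Data.Nat using (ℕ; suc; _+_; _∸_; _≤_; _<_; z≤n; s≤s; NonZero; parity)
open import Data.Nat.Properties
open import Data.Nat.DivMod using (_/_; _%_; m%n<n; %-distribˡ-+; %-remove-+ˡ; m%n%n≡m%n; [m+n]%n≡m%n; m<n⇒m%n≡m; n%n≡0; m*n/n≡m)
open import Data.Nat.Divisibility using (_∣_; divides; ∣-refl)
open import Data.Fin using (Fin; toℕ; fromℕ<)
open import Data.Fin.Properties using (toℕ-fromℕ<; toℕ-injective; toℕ<n)
open import Data.Parity.Base using (Parity; 0ℙ; 1ℙ; _⁻¹; toSign)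
import Data.Parity.Properties as ℙ
open import Data.Sign.Base as 𝕊 using (Sign; opposite)
open import Data.Sign.Properties using (s*s≡+; s≢opposite[s]) renaming (*-assoc to *ˢ-assoc)
open import Data.Product using (Σ; _×_; _,_; proj₁; proj₂; map₂)
open import Data.Sum as Sum using (_⊎_; inj₁; inj₂)
open import Data.Empty using (⊥; ⊥-elim)
open import Function.Definitions using (Injective; Surjective)
open import Relation.Binary.PropositionalEquality

private variable
  k s t : ℕ

[m%n+o]%n≡[m+o]%n : ∀ m o n .{{_ : NonZero n}} → (m % n + o) % n ≡ (m + o) % n
[m%n+o]%n≡[m+o]%n m o n = begin
  (m % n + o) % n         ≡⟨ %-distribˡ-+ (m % n) o n ⟩
  (m % n % n + o % n) % n ≡⟨ cong (λ x → (x + o % n) % n) (m%n%n≡m%n m n) ⟩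
  (m % n + o % n) % n     ≡⟨ %-distribˡ-+ m o n ⟨
  (m + o) % n             ∎
  where open ≡-Reasoning

[m+o%n]%n≡[m+o]%n : ∀ m o n .{{_ : NonZero n}} → (m + o % n) % n ≡ (m + o) % n
[m+o%n]%n≡[m+o]%n m o n = begin
  (m + o % n) % n ≡⟨ cong (_% n) (+-comm m (o % n)) ⟩
  (o % n + m) % n ≡⟨ [m%n+o]%n≡[m+o]%n o m n ⟩
  (o + m) % n     ≡⟨ cong (_% n) (+-comm o m) ⟩
  (m + o) % n     ∎
  where open ≡-Reasoning

parity-suc : ∀ n → parity (suc n) ≡ parity n ⁻¹
parity-suc n = trans (sym (ℙ.⁻¹-involutive (parity (suc n)))) (cong _⁻¹ (ℙ.suc-homo-⁻¹ n))

parity-even : ∀ {n} → 2 ∣ n → parity n ≡ 0ℙ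
parity-even (divides q refl) = trans (ℙ.*-homo-* q 2) (ℙ.*-zeroʳ (parity q))

0<m≤n∸1⇒m<n : ∀ {m n} → 0 < m → m ≤ n ∸ 1 → m < n
0<m≤n∸1⇒m<n {n = suc _} _   m≤n-1 = s≤s m≤n-1
0<m≤n∸1⇒m<n {n = 0}     0<m m≤0   = ⊥-elim (<⇒≱ 0<m m≤0)

half-bound : ∀ {n d} → 2 ∣ n → 0 < d → d ≤ n / 2 ∸ 1 → d + d < n
half-bound {d = d} (divides p refl) 0<d d≤ =
  subst (d + d <_) (trans (cong (p +_) (sym (+-identityʳ p))) (*-comm 2 p)) (+-mono-< d<p d<p)
  where
    d<p : d < p
    d<p = 0<m≤n∸1⇒m<n 0<d (subst (λ h → d ≤ h ∸ 1) (m*n/n≡m p 2) d≤)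

-- a ↦ a + s in ℤ_(k+1); the cyclic successor next a of Defs is shift 1 a by definition.
shift : ℕ → Fin (suc k) → Fin (suc k)
shift {k} s a = fromℕ< (m%n<n (s + toℕ a) (suc k))

toℕ-shift : ∀ s (a : Fin (suc k)) → toℕ (shift s a) ≡ (s + toℕ a) % suc k
toℕ-shift {k} s a = toℕ-fromℕ< (m%n<n (s + toℕ a) (suc k))

shift-zero : (a : Fin (suc k)) → shift 0 a ≡ a
shift-zero a = toℕ-injective (trans (toℕ-shift 0 a) (m<n⇒m%n≡m (toℕ<n a)))

shift-modulus : (a : Fin (suc k)) → shift (suc k) a ≡ a
shift-modulus {k} a = toℕ-injective (begin
  toℕ (shift (suc k) a)   ≡⟨ toℕ-shift (suc k) a ⟩
  (suc k + toℕ a) % suc k ≡⟨ %-remove-+ˡ (toℕ a) ∣-refl ⟩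
  toℕ a % suc k           ≡⟨ m<n⇒m%n≡m (toℕ<n a) ⟩
  toℕ a                   ∎)
  where open ≡-Reasoning

shift-shift : ∀ s t (a : Fin (suc k)) → shift s (shift t a) ≡ shift (s + t) a
shift-shift {k} s t a = toℕ-injective (begin
  toℕ (shift s (shift t a))         ≡⟨ toℕ-shift s (shift t a) ⟩
  (s + toℕ (shift t a)) % suc k     ≡⟨ cong (λ x → (s + x) % suc k) (toℕ-shift t a) ⟩
  (s + (t + toℕ a) % suc k) % suc k ≡⟨ [m+o%n]%n≡[m+o]%n s (t + toℕ a) (suc k) ⟩
  (s + (t + toℕ a)) % suc k         ≡⟨ cong (_% suc k) (+-assoc s t (toℕ a)) ⟨
  (s + t + toℕ a) % suc k           ≡⟨ toℕ-shift (s + t) a ⟨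
  toℕ (shift (s + t) a)             ∎)
  where open ≡-Reasoning

shift-∸-shift : s ≤ suc k → (a : Fin (suc k)) → shift (suc k ∸ s) (shift s a) ≡ a
shift-∸-shift {s} {k} s≤k a = begin
  shift (suc k ∸ s) (shift s a) ≡⟨ shift-shift (suc k ∸ s) s a ⟩
  shift (suc k ∸ s + s) a       ≡⟨ cong (λ x → shift x a) (m∸n+n≡m s≤k) ⟩
  shift (suc k) a               ≡⟨ shift-modulus a ⟩
  a                             ∎
  where open ≡-Reasoning

shift-shift-∸ : s ≤ suc k → (a : Fin (suc k)) → shift s (shift (suc k ∸ s) a) ≡ a
shift-shift-∸ {s} {k} s≤k a = begin
  shift s (shift (suc k ∸ s) a) ≡⟨ shift-shift s (suc k ∸ s) a ⟩
  shift (s + (suc k ∸ s)) a     ≡⟨ cong (λ x → shift x a) (m+[n∸m]≡n s≤k) ⟩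
  shift (suc k) a               ≡⟨ shift-modulus a ⟩
  a                             ∎
  where open ≡-Reasoning

shift-injective : s ≤ suc k → Injective _≡_ _≡_ (shift {k} s)
shift-injective {s} {k} s≤k {a} {b} eq = begin
  a                             ≡⟨ shift-∸-shift s≤k a ⟨
  shift (suc k ∸ s) (shift s a) ≡⟨ cong (shift (suc k ∸ s)) eq ⟩
  shift (suc k ∸ s) (shift s b) ≡⟨ shift-∸-shift s≤k b ⟩
  b                             ∎
  where open ≡-Reasoning

shift-flip : s ≤ suc k → {a b : Fin (suc k)} → a ≡ shift s b → b ≡ shift (suc k ∸ s) a
shift-flip s≤k {b = b} refl = sym (shift-∸-shift s≤k b)

diffMod-shift : s < suc k → (a : Fin (suc k)) → diffMod (suc k) (shift s a) a ≡ s
diffMod-shift {s} {k} s<k a = begin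
  (toℕ (shift s a) + (suc k ∸ toℕ a)) % suc k    ≡⟨ cong (λ x → (x + (suc k ∸ toℕ a)) % suc k) (toℕ-shift s a) ⟩
  ((s + toℕ a) % suc k + (suc k ∸ toℕ a)) % suc k ≡⟨ [m%n+o]%n≡[m+o]%n (s + toℕ a) (suc k ∸ toℕ a) (suc k) ⟩
  (s + toℕ a + (suc k ∸ toℕ a)) % suc k          ≡⟨ cong (_% suc k) (+-assoc s (toℕ a) (suc k ∸ toℕ a)) ⟩
  (s + (toℕ a + (suc k ∸ toℕ a))) % suc k        ≡⟨ cong (λ x → (s + x) % suc k) (m+[n∸m]≡n (<⇒≤ (toℕ<n a))) ⟩
  (s + suc k) % suc k                            ≡⟨ [m+n]%n≡m%n s (suc k) ⟩
  s % suc k                                      ≡⟨ m<n⇒m%n≡m s<k ⟩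
  s                                              ∎
  where open ≡-Reasoning

shift-diffMod : (a b : Fin (suc k)) → shift (diffMod (suc k) a b) b ≡ a
shift-diffMod {k} a b = toℕ-injective (begin
  toℕ (shift (diffMod (suc k) a b) b)                ≡⟨ toℕ-shift (diffMod (suc k) a b) b ⟩
  ((toℕ a + (suc k ∸ toℕ b)) % suc k + toℕ b) % suc k ≡⟨ [m%n+o]%n≡[m+o]%n (toℕ a + (suc k ∸ toℕ b)) (toℕ b) (suc k) ⟩
  (toℕ a + (suc k ∸ toℕ b) + toℕ b) % suc k          ≡⟨ cong (_% suc k) (+-assoc (toℕ a) (suc k ∸ toℕ b) (toℕ b)) ⟩
  (toℕ a + (suc k ∸ toℕ b + toℕ b)) % suc k          ≡⟨ cong (λ x → (toℕ a + x) % suc k) (m∸n+n≡m (<⇒≤ (toℕ<n b))) ⟩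
  (toℕ a + suc k) % suc k                            ≡⟨ [m+n]%n≡m%n (toℕ a) (suc k) ⟩
  toℕ a % suc k                                      ≡⟨ m<n⇒m%n≡m (toℕ<n a) ⟩
  toℕ a                                              ∎)
  where open ≡-Reasoning

diffMod≡⇒shift : {a b : Fin (suc k)} → diffMod (suc k) a b ≡ s → a ≡ shift s b
diffMod≡⇒shift {a = a} {b} refl = sym (shift-diffMod a b)

shift⇒diffMod≡∸ : 0 < s → s ≤ suc k → {a b : Fin (suc k)} → b ≡ shift s a →
                  diffMod (suc k) a b ≡ suc k ∸ s
shift⇒diffMod≡∸ {s} {k} 0<s s≤k {a} {b} b≡ = begin
  diffMod (suc k) a b                       ≡⟨ cong (λ x → diffMod (suc k) x b) (shift-flip s≤k b≡) ⟩
  diffMod (suc k) (shift (suc k ∸ s) b) b   ≡⟨ diffMod-shift (∸-monoʳ-< 0<s s≤k) b ⟩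
  suc k ∸ s                                 ∎
  where open ≡-Reasoning

shift-cancelʳ : s < suc k → t < suc k → (a : Fin (suc k)) → shift s a ≡ shift t a → s ≡ t
shift-cancelʳ {s} {k} {t} s<k t<k a eq = begin
  s                             ≡⟨ diffMod-shift s<k a ⟨
  diffMod (suc k) (shift s a) a ≡⟨ cong (λ x → diffMod (suc k) x a) eq ⟩
  diffMod (suc k) (shift t a) a ≡⟨ diffMod-shift t<k a ⟩
  t                             ∎
  where open ≡-Reasoning

next-next-≢ : 3 ≤ suc k → (i : Fin (suc k)) → next (next i) ≢ i
next-next-≢ 3≤k i eq = 1+n≢0 (shift-cancelʳ 3≤k (s≤s z≤n) i (begin
  shift 2 i     ≡⟨ shift-shift 1 1 i ⟨
  next (next i) ≡⟨ eq ⟩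
  i             ≡⟨ shift-zero i ⟨
  shift 0 i     ∎))
  where open ≡-Reasoning

parity-next : 2 ∣ suc k → (i : Fin (suc k)) → parity (toℕ (next i)) ≡ parity (toℕ i) ⁻¹
parity-next {k} even i with m≤n⇒m<n∨m≡n (toℕ<n i)
... | inj₁ 1+i<k = begin
  parity (toℕ (next i))         ≡⟨ cong parity (toℕ-shift 1 i) ⟩
  parity (suc (toℕ i) % suc k)  ≡⟨ cong parity (m<n⇒m%n≡m 1+i<k) ⟩
  parity (suc (toℕ i))          ≡⟨ parity-suc (toℕ i) ⟩
  parity (toℕ i) ⁻¹             ∎
  where open ≡-Reasoning
... | inj₂ 1+i≡k = begin
  parity (toℕ (next i))         ≡⟨ cong parity (toℕ-shift 1 i) ⟩
  parity (suc (toℕ i) % suc k)  ≡⟨ cong (λ x → parity (x % suc k)) 1+i≡k ⟩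
  parity (suc k % suc k)        ≡⟨ cong parity (n%n≡0 (suc k)) ⟩
  0ℙ                            ≡⟨ parity-even even ⟨
  parity (suc k)                ≡⟨ cong parity 1+i≡k ⟨
  parity (suc (toℕ i))          ≡⟨ parity-suc (toℕ i) ⟩
  parity (toℕ i) ⁻¹             ∎
  where open ≡-Reasoning

factorEdge-sym : {V : Set} {G : Graph V} (F : CFactor G k) {u v : V} →
                 FactorEdge F u v → FactorEdge F v u
factorEdge-sym _ (j , i , e) = j , i , Sum.swap e

bySign : {P : Sign → Set} → Σ Sign P → P 𝕊.+ ⊎ P 𝕊.-
bySign (𝕊.+ , p) = inj₁ p
bySign (𝕊.- , p) = inj₂ p

module ZigZag (m-1 n-1 d : ℕ) (m-even : 2 ∣ suc m-1) (3≤m : 3 ≤ suc m-1)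
              (0<d : 0 < d) (d<n : d < suc n-1) (d+d≢n : d + d ≢ suc n-1) where

  m n : ℕ
  m = suc m-1
  n = suc n-1

  stepOf : Sign → ℕ
  stepOf 𝕊.+ = d
  stepOf 𝕊.- = n ∸ d

  stepOf-≤ : ∀ σ → stepOf σ ≤ n
  stepOf-≤ 𝕊.+ = <⇒≤ d<n
  stepOf-≤ 𝕊.- = m∸n≤m n d

  stepOf-< : ∀ σ → stepOf σ < n
  stepOf-< 𝕊.+ = d<n
  stepOf-< 𝕊.- = ∸-monoʳ-< 0<d (<⇒≤ d<n)

  stepOf-positive : ∀ σ → 0 < stepOf σ
  stepOf-positive 𝕊.+ = 0<d
  stepOf-positive 𝕊.- = m<n⇒0<n∸m d<n

  stepOf-opposite : ∀ σ → stepOf (opposite σ) ≡ n ∸ stepOf σ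
  stepOf-opposite 𝕊.+ = refl
  stepOf-opposite 𝕊.- = sym (m∸[m∸n]≡n (<⇒≤ d<n))

  stepOf-±d : ∀ σ → stepOf σ ≡ d ⊎ stepOf σ ≡ n ∸ d
  stepOf-±d 𝕊.+ = inj₁ refl
  stepOf-±d 𝕊.- = inj₂ refl

  d≢n∸d : d ≢ n ∸ d
  d≢n∸d eq = d+d≢n (trans (cong (d +_) eq) (m+[n∸m]≡n (<⇒≤ d<n)))

  stepOf-injective : ∀ σ τ → stepOf σ ≡ stepOf τ → σ ≡ τ
  stepOf-injective 𝕊.+ 𝕊.+ _  = refl
  stepOf-injective 𝕊.- 𝕊.- _  = refl
  stepOf-injective 𝕊.+ 𝕊.- eq = ⊥-elim (d≢n∸d eq)
  stepOf-injective 𝕊.- 𝕊.+ eq = ⊥-elim (d≢n∸d (sym eq))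

  offset : Sign → Parity → ℕ
  offset σ 0ℙ = 0
  offset σ 1ℙ = stepOf σ

  offset-≤ : ∀ σ p → offset σ p ≤ n
  offset-≤ σ 0ℙ = z≤n
  offset-≤ σ 1ℙ = stepOf-≤ σ

  direction : Sign → Fin m → Sign
  direction σ i = toSign (parity (toℕ i)) 𝕊.* σ

  direction-direction : ∀ σ i → direction (direction σ i) i ≡ σ
  direction-direction σ i = begin
    ε 𝕊.* (ε 𝕊.* σ) ≡⟨ *ˢ-assoc ε ε σ ⟨
    (ε 𝕊.* ε) 𝕊.* σ ≡⟨ cong (𝕊._* σ) (s*s≡+ ε) ⟩
    σ               ∎
    where open ≡-Reasoning
          ε = toSign (parity (toℕ i))

  direction-injective : ∀ {σ τ} i → direction σ i ≡ direction τ i → σ ≡ τ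
  direction-injective {σ} {τ} i eq = begin
    σ                           ≡⟨ direction-direction σ i ⟨
    direction (direction σ i) i ≡⟨ cong (λ ρ → direction ρ i) eq ⟩
    direction (direction τ i) i ≡⟨ direction-direction τ i ⟩
    τ                           ∎
    where open ≡-Reasoning

  zigzag : Sign → Fin n × Fin m → Fin m × Fin n
  zigzag σ (j , i) = i , shift (offset σ (parity (toℕ i))) j

  offset-step : ∀ σ p (j : Fin n) →
                shift (offset σ (p ⁻¹)) j ≡ shift (stepOf (toSign p 𝕊.* σ)) (shift (offset σ p) j)
  offset-step σ 0ℙ j = cong (shift (stepOf σ)) (sym (shift-zero j))
  offset-step σ 1ℙ j = begin
    shift 0 j                                         ≡⟨ shift-zero j ⟩
    j                                                 ≡⟨ shift-∸-shift (stepOf-≤ σ) j ⟨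
    shift (n ∸ stepOf σ) (shift (stepOf σ) j)         ≡⟨ cong (λ s → shift s (shift (stepOf σ) j)) (stepOf-opposite σ) ⟨
    shift (stepOf (opposite σ)) (shift (stepOf σ) j)  ∎
    where open ≡-Reasoning

  record Arc (s : ℕ) (u v : Fin m × Fin n) : Set where
    constructor arc
    field
      column : proj₁ v ≡ next (proj₁ u)
      row    : proj₂ v ≡ shift s (proj₂ u)

  zigzag-arc : ∀ σ j i → Arc (stepOf (direction σ i)) (zigzag σ (j , i)) (zigzag σ (j , next i))
  zigzag-arc σ j i = arc refl (trans (cong (λ p → shift (offset σ p) j) (parity-next m-even i))
                                  (offset-step σ (parity (toℕ i)) j))

  zigzag-section : ∀ σ i (y : Fin n) → zigzag σ (shift (n ∸ offset σ (parity (toℕ i))) y , i) ≡ (i , y)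
  zigzag-section σ i y = cong (i ,_) (shift-shift-∸ (offset-≤ σ (parity (toℕ i))) y)

  zigzag-injective : ∀ σ → Injective _≡_ _≡_ (zigzag σ)
  zigzag-injective σ {j , i} {j′ , i′} eq with refl ← cong proj₁ eq =
    cong (_, i) (shift-injective (offset-≤ σ (parity (toℕ i))) (cong proj₂ eq))

  zigzag-surjective : ∀ σ → Surjective _≡_ _≡_ (zigzag σ)
  zigzag-surjective σ (i , y) = (_ , i) , λ { refl → zigzag-section σ i y }

  arc-edge : ∀ τ {u v} → Arc (stepOf τ) u v → CayPM m n d u v
  arc-edge τ {i , y} {i′ , y′} (arc i′≡ y′≡) =
    inj₂ column , Sum.map (trans row) (trans row) (stepOf-±d (opposite τ))
    where
      column : diffMod m i i′ ≡ m ∸ 1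
      column = shift⇒diffMod≡∸ (s≤s z≤n) (s≤s z≤n) i′≡
      row : diffMod n y y′ ≡ stepOf (opposite τ)
      row = trans (shift⇒diffMod≡∸ (stepOf-positive τ) (stepOf-≤ τ) y′≡) (sym (stepOf-opposite τ))

  factor : Sign → CFactor (CayPM m n d) m
  factor σ = record
    { t      = n
    ; vertex = zigzag σ
    ; bij    = zigzag-injective σ , zigzag-surjective σ
    ; inG    = λ j i → arc-edge (direction σ i) (zigzag-arc σ j i)
    }

  row-step : {y y′ : Fin n} → diffMod n y y′ ≡ d ⊎ diffMod n y y′ ≡ n ∸ d →
             Σ Sign λ τ → y ≡ shift (stepOf τ) y′
  row-step (inj₁ e) = 𝕊.+ , diffMod≡⇒shift e
  row-step (inj₂ e) = 𝕊.- , diffMod≡⇒shift e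

  edge-arc : ∀ {u v} → CayPM m n d u v → Σ Sign λ τ → Arc (stepOf τ) u v ⊎ Arc (stepOf τ) v u
  edge-arc {i , _} (inj₁ column , row) with τ , y≡ ← row-step row =
    τ , inj₂ (arc (diffMod≡⇒shift {a = i} column) y≡)
  edge-arc {i , y} {i′ , y′} (inj₂ column , row) with τ , y≡ ← row-step row =
    opposite τ , inj₁ (arc i′≡ y′≡)
    where
      i′≡ : i′ ≡ next i
      i′≡ = subst (λ s → i′ ≡ shift s i) (m∸[m∸n]≡n {m} {1} (s≤s z≤n))
                  (shift-flip (m∸n≤m m 1) (diffMod≡⇒shift {a = i} column))
      y′≡ : y′ ≡ shift (stepOf (opposite τ)) y
      y′≡ = trans (shift-flip (stepOf-≤ τ) y≡) (cong (λ s → shift s y) (sym (stepOf-opposite τ)))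

  arc-factorEdge : ∀ τ {u v} → Arc (stepOf τ) u v → Σ Sign λ σ → FactorEdge (factor σ) u v
  arc-factorEdge τ {i , y} (arc refl refl) =
    σ , j , i , inj₁ (sym (zigzag-section σ i y) , cong (next i ,_) (sym step))
    where
      σ = direction τ i
      j = shift (n ∸ offset σ (parity (toℕ i))) y
      step : proj₂ (zigzag σ (j , next i)) ≡ shift (stepOf τ) y
      step = begin
        proj₂ (zigzag σ (j , next i))                             ≡⟨ Arc.row (zigzag-arc σ j i) ⟩
        shift (stepOf (direction σ i)) (proj₂ (zigzag σ (j , i))) ≡⟨ cong₂ (λ ρ x → shift (stepOf ρ) x)
                                                                           (direction-direction τ i)
                                                                           (cong proj₂ (zigzag-section σ i y)) ⟩
        shift (stepOf τ) y                                        ∎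
        where open ≡-Reasoning

  cover : ∀ u v → CayPM m n d u v → FactorEdge (factor 𝕊.+) u v ⊎ FactorEdge (factor 𝕊.-) u v
  cover u v uv with edge-arc uv
  ... | τ , inj₁ uv⃗ = bySign (arc-factorEdge τ uv⃗)
  ... | τ , inj₂ vu⃗ = bySign (map₂ (λ {σ} → factorEdge-sym (factor σ)) (arc-factorEdge τ vu⃗))

  factorEdge-arc : ∀ σ {u v} → FactorEdge (factor σ) u v →
                   Arc (stepOf (direction σ (proj₁ u))) u v ⊎ Arc (stepOf (direction σ (proj₁ v))) v u
  factorEdge-arc σ (j , i , inj₁ (refl , refl)) = inj₁ (zigzag-arc σ j i)
  factorEdge-arc σ (j , i , inj₂ (refl , refl)) = inj₂ (zigzag-arc σ j i)

  arc-step-unique : ∀ {s t u v} → s < n → t < n → Arc s u v → Arc t u v → s ≡ t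
  arc-step-unique {u = i , y} s<n t<n (arc _ e) (arc _ e′) = shift-cancelʳ s<n t<n y (trans (sym e) e′)

  arc-irreversible : ∀ {s t u v} → Arc s u v → Arc t v u → ⊥
  arc-irreversible {u = i , _} (arc e _) (arc e′ _) = next-next-≢ 3≤m i (trans (cong next (sym e)) (sym e′))

  arcs-of-opposite-factors : ∀ {u v} → Arc (stepOf (direction 𝕊.+ (proj₁ u))) u v →
                             Arc (stepOf (direction 𝕊.- (proj₁ u))) u v → ⊥
  arcs-of-opposite-factors {i , _} a b =
    s≢opposite[s] 𝕊.+
      (direction-injective i (stepOf-injective (direction 𝕊.+ i) (direction 𝕊.- i) same-step))
    where
      same-step : stepOf (direction 𝕊.+ i) ≡ stepOf (direction 𝕊.- i)
      same-step = arc-step-unique (stepOf-< (direction 𝕊.+ i)) (stepOf-< (direction 𝕊.- i)) a b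

  disjoint : ∀ u v → FactorEdge (factor 𝕊.+) u v → FactorEdge (factor 𝕊.-) u v → ⊥
  disjoint u v e₊ e₋ with factorEdge-arc 𝕊.+ e₊ | factorEdge-arc 𝕊.- e₋
  ... | inj₁ a | inj₁ b = arcs-of-opposite-factors a b
  ... | inj₂ a | inj₂ b = arcs-of-opposite-factors a b
  ... | inj₁ a | inj₂ b = arc-irreversible a b
  ... | inj₂ a | inj₁ b = arc-irreversible b a

  twoFactorization : TwoCFactorization (CayPM m n d) m
  twoFactorization = record
    { k≥3      = 3≤m
    ; F₁       = factor 𝕊.+
    ; F₂       = factor 𝕊.-
    ; cover    = cover
    ; disjoint = disjoint
    }

lemma2p6 : (m n d : ℕ) → 4 ≤ m → 4 ≤ n → 2 ∣ m → 2 ∣ n →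
           1 ≤ d → d ≤ n / 2 ∸ 1 →
           TwoCFactorization (CayPM m n d) m
lemma2p6 (suc m-1) (suc n-1) d 4≤m _ m-even n-even 1≤d d≤ =
  ZigZag.twoFactorization m-1 n-1 d m-even (≤-trans (n≤1+n 3) 4≤m) 1≤d
                          (≤-trans (s≤s (m≤m+n d d)) d+d<n) (<⇒≢ d+d<n)
  where
    d+d<n : d + d < suc n-1
    d+d<n = half-bound n-even 1≤d d≤
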